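{- Let $G$ be a $k$-$\gamma_c$-critical graph having at least one cut vertex, let $\mathcal{C}$ be the set of cut vertices of $G$, let $D$ be a $\gamma_c$-set of $G$, let $B$ be a block of $G$, let $x,y\in V(B)$ with $xy\notin E(G)$, and let $D_{xy}$ be a $\gamma_c$-set of $G+xy$. Then $D\cap\mathcal{C} = D_{xy}\cap\mathcal{C}$; in particular $D\cap \mathcal{C}\cap V(B') = D_{xy}\cap\mathcal{C}\cap V(B')$ for every block $B'$ of $G+xy$.
   Context: A connected dominating set of $G$ is a set $D$ such that every vertex is in $D$ or adjacent to a vertex of $D$ and $G[D]$ is connected; $\gamma_c(G)$ is its minimum size, and a minimum one is a $\gamma_c$-set. $G$ is $k$-$\gamma_c$-critical if $\gamma_c(G)=k$ and $\gamma_c(G+uv)<k$ for all non-adjacent $u,v$. -}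

module Defs where

open import Level using (0ℓ)
open import Data.Nat using (ℕ; _≤_; _<_)
open import Data.Fin using (Fin)
open import Data.Fin.Subset using (Subset; _∈_; _⊆_; ∣_∣)
open import Data.Product using (Σ; ∃; ∃-syntax; _×_; _,_)
open import Data.Sum using (_⊎_)
open import Data.Unit using (⊤)
open import Relation.Nullary using (¬_)
open import Relation.Binary.PropositionalEquality using (_≡_; _≢_)

record Graph (n : ℕ) : Set₁ where
  field
    E      : Fin n → Fin n → Set
    E-sym    : ∀ {u v} → E u v → E v u
    E-irrefl : ∀ {v} → ¬ E v v
open Graph public

addEdge : ∀ {n} (G : Graph n) (x y : Fin n) → x ≢ y → Graph n
addEdge G x y x≢y = record
  { E      = λ u v → E G u v ⊎ ((u ≡ x × v ≡ y) ⊎ (u ≡ y × v ≡ x))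
  ; E-sym    = symm
  ; E-irrefl = irr
  }
  where
  open import Data.Sum using (inj₁; inj₂)
  open import Relation.Binary.PropositionalEquality using (refl; trans) renaming (sym to ≡sym)
  symm : ∀ {u v} → E G u v ⊎ ((u ≡ x × v ≡ y) ⊎ (u ≡ y × v ≡ x)) → E G v u ⊎ ((v ≡ x × u ≡ y) ⊎ (v ≡ y × u ≡ x))
  symm (inj₁ e) = inj₁ (Graph.E-sym G e)
  symm (inj₂ (inj₁ (p , q))) = inj₂ (inj₂ (q , p))
  symm (inj₂ (inj₂ (p , q))) = inj₂ (inj₁ (q , p))
  irr : ∀ {v} → ¬ (E G v v ⊎ ((v ≡ x × v ≡ y) ⊎ (v ≡ y × v ≡ x)))
  irr (inj₁ e) = Graph.E-irrefl G e
  irr (inj₂ (inj₁ (p , q))) = x≢y (trans (≡sym p) q)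
  irr (inj₂ (inj₂ (p , q))) = x≢y (trans (≡sym q) p)

-- Walks in G all of whose vertices satisfy P (walks in the subgraph induced by P).
data Reach {n} (G : Graph n) (P : Fin n → Set) : Fin n → Fin n → Set where
  here : ∀ {a} → P a → Reach G P a a
  step : ∀ {a c b} → P a → E G a c → Reach G P c b → Reach G P a b

ConnectedOn : ∀ {n} → Graph n → (Fin n → Set) → Set
ConnectedOn G P = (∃[ a ] P a) × (∀ a b → P a → P b → Reach G P a b)

-- v is a cut vertex of the induced subgraph G[P]: deleting v increases the
-- number of components, i.e. some a, b ≠ v connected in G[P] are disconnected in G[P] − v.
CutVertexOn : ∀ {n} → Graph n → (Fin n → Set) → Fin n → Set
CutVertexOn G P v =
  P v × ∃[ a ] ∃[ b ] (a ≢ v × b ≢ v × Reach G P a b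
                       × ¬ Reach G (λ w → P w × w ≢ v) a b)

IsCutVertex : ∀ {n} → Graph n → Fin n → Set
IsCutVertex G v = CutVertexOn G (λ _ → ⊤) v

-- B is (the vertex set of) a block of G: a maximal connected subgraph without
-- a cut vertex (maximal such subgraphs are induced, so a vertex set suffices).
NoCutBlock : ∀ {n} → Graph n → Subset n → Set
NoCutBlock G S = ConnectedOn G (_∈ S) × (∀ v → ¬ CutVertexOn G (_∈ S) v)

IsBlock : ∀ {n} → Graph n → Subset n → Set
IsBlock G B = NoCutBlock G B × (∀ S → B ⊆ S → NoCutBlock G S → S ⊆ B)

Dominating : ∀ {n} → Graph n → Subset n → Set
Dominating G D = ∀ v → v ∈ D ⊎ (∃[ u ] (u ∈ D × E G v u))

IsCDS : ∀ {n} → Graph n → Subset n → Set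
IsCDS G D = Dominating G D × ConnectedOn G (_∈ D)

IsGammaCSet : ∀ {n} → Graph n → Subset n → Set
IsGammaCSet G D = IsCDS G D × (∀ D' → IsCDS G D' → ∣ D ∣ ≤ ∣ D' ∣)

GammaC≡ : ∀ {n} → Graph n → ℕ → Set
GammaC≡ G k = ∃[ D ] (IsGammaCSet G D × ∣ D ∣ ≡ k)

IsCritical : ∀ {n} → ℕ → Graph n → Set
IsCritical k G =
  GammaC≡ G k ×
  (∀ u v (u≢v : u ≢ v) → ¬ E G u v →
     ∃[ m ] (GammaC≡ (addEdge G u v u≢v) m × m < k))

-- Say v separates a from b in a graph when a, b ≠ v and no walk from a
-- to b avoids v.  (1) A connected dominating set D must contain every
-- separating vertex v: otherwise a and b each reach D avoiding v, and D is
-- connected avoiding v.  (2) A cut vertex of G separates some pair in G.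
-- (3) If v does not separate x from y, then adding the edge xy
-- creates no walk avoiding v that did not exist before, so v still separates
-- the same pair in G + xy.  (4) No vertex v separates two vertices of a block:
-- they are joined inside the block if v is outside it, and a block has no cut
-- vertex otherwise.  Separation being negative, (3) and (4) are phrased with a
-- doubly negated joining walk, which is all that is constructively available.  Hence every cut vertex of G lies in
-- both D and Dxy, which gives both conjuncts of lemma11 at once.
module Submission where

open import Defs
open import Data.Nat using (ℕ)
open import Data.Fin using (Fin; _≟_)
open import Data.Fin.Subset using (Subset; _∈_)
open import Data.Fin.Subset.Properties using (_∈?_)
open import Data.Product using (∃-syntax; _×_; _,_; proj₁; proj₂)
open import Data.Sum using (inj₁; inj₂)
open import Data.Empty using (⊥-elim)
open import Relation.Nullary using (¬_; yes; no)
open import Relation.Binary.PropositionalEquality using (_≢_; refl; subst)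
open import Function.Bundles using (_⇔_; mk⇔)

Avoiding : ∀ {n} → Graph n → Fin n → Fin n → Fin n → Set
Avoiding G v a b = Reach G (λ w → w ≢ v) a b

Separates : ∀ {n} → Graph n → Fin n → Fin n → Fin n → Set
Separates G v a b = a ≢ v × b ≢ v × ¬ Avoiding G v a b

module Walks {n} (G : Graph n) where

  weaken : ∀ {P Q : Fin n → Set} → (∀ {w} → P w → Q w)
         → ∀ {a b} → Reach G P a b → Reach G Q a b
  weaken f (here p)     = here (f p)
  weaken f (step p e r) = step (f p) e (weaken f r)

  start : ∀ {P a b} → Reach G P a b → P a
  start (here p)     = p
  start (step p _ _) = p

  _++_ : ∀ {P a b c} → Reach G P a b → Reach G P b c → Reach G P a c
  here _     ++ s = s
  step p e r ++ s = step p e (r ++ s)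

  reverse : ∀ {P a b} → Reach G P a b → Reach G P b a
  reverse (here p)     = here p
  reverse (step p e r) = reverse r ++ step (start r) (E-sym G e) (here p)

open Walks

cds-contains-separator : ∀ {n} (G : Graph n) (D : Subset n) → IsCDS G D
                       → ∀ {v a b} → Separates G v a b → v ∈ D
cds-contains-separator G D (dom , _ , conn) {v} {a} {b} (a≢v , b≢v , apart) with v ∈? D
... | yes v∈D = v∈D
... | no  v∉D = ⊥-elim (apart (_++_ G ra (_++_ G through (reverse G rb))))
  where
  avoidsV : ∀ {u} → u ∈ D → u ≢ v
  avoidsV u∈D refl = v∉D u∈D

  reachD : ∀ {u} → u ≢ v → ∃[ d ] (d ∈ D × Avoiding G v u d)
  reachD {u} u≢v with dom u
  ... | inj₁ u∈D           = u , u∈D , here u≢v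
  ... | inj₂ (d , d∈D , e) = d , d∈D , step u≢v e (here (avoidsV d∈D))

  da : ∃[ d ] (d ∈ D × Avoiding G v a d)
  da = reachD a≢v
  db : ∃[ d ] (d ∈ D × Avoiding G v b d)
  db = reachD b≢v
  ra : Avoiding G v a (proj₁ da)
  ra = proj₂ (proj₂ da)
  rb : Avoiding G v b (proj₁ db)
  rb = proj₂ (proj₂ db)
  through : Avoiding G v (proj₁ da) (proj₁ db)
  through = weaken G avoidsV (conn _ _ (proj₁ (proj₂ da)) (proj₁ (proj₂ db)))

cut-vertex-separates : ∀ {n} (G : Graph n) {v} → IsCutVertex G v
                     → ∃[ a ] ∃[ b ] Separates G v a b
cut-vertex-separates G (_ , a , b , a≢v , b≢v , _ , apart) =
  a , b , a≢v , b≢v , λ r → apart (weaken G (λ p → _ , p) r)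

reroute : ∀ {n} (G : Graph n) x y (x≢y : x ≢ y) v
        → (x ≢ v → y ≢ v → Avoiding G v x y)
        → ∀ {a b} → Avoiding (addEdge G x y x≢y) v a b → Avoiding G v a b
reroute G x y x≢y v join (here p) = here p
reroute G x y x≢y v join (step p (inj₁ e) r) =
  step p e (reroute G x y x≢y v join r)
reroute G x y x≢y v join (step p (inj₂ (inj₁ (refl , refl))) r) =
  _++_ G (join p (start _ r)) (reroute G x y x≢y v join r)
reroute G x y x≢y v join (step p (inj₂ (inj₂ (refl , refl))) r) =
  _++_ G (reverse G (join (start _ r) p)) (reroute G x y x≢y v join r)

separation-persists : ∀ {n} (G : Graph n) x y (x≢y : x ≢ y) v
                    → (x ≢ v → y ≢ v → ¬ ¬ Avoiding G v x y)
                    → ∀ {a b} → Separates G v a b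
                    → Separates (addEdge G x y x≢y) v a b
separation-persists G x y x≢y v join {a} {b} (a≢v , b≢v , apart) =
  a≢v , b≢v , noWalk
  where
  noWalk : ¬ Avoiding (addEdge G x y x≢y) v a b
  noWalk r with x ≟ v | y ≟ v
  ... | yes x≡v | _       = apart (reroute G x y x≢y v (λ x≢v _ → ⊥-elim (x≢v x≡v)) r)
  ... | no _    | yes y≡v = apart (reroute G x y x≢y v (λ _ y≢v → ⊥-elim (y≢v y≡v)) r)
  ... | no x≢v  | no y≢v  =
    join x≢v y≢v (λ xy → apart (reroute G x y x≢y v (λ _ _ → xy) r))

block-not-separated : ∀ {n} (G : Graph n) (B : Subset n) → NoCutBlock G B
                    → ∀ {x y} → x ∈ B → y ∈ B
                    → ∀ v → x ≢ v → y ≢ v → ¬ ¬ Avoiding G v x y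
block-not-separated G B ((_ , connB) , nocutB) {x} {y} x∈B y∈B v x≢v y≢v
  with v ∈? B
... | no v∉B  = λ apart → apart (weaken G outsideB (connB x y x∈B y∈B))
  where
  outsideB : ∀ {w} → w ∈ B → w ≢ v
  outsideB w∈B w≡v = v∉B (subst (_∈ B) w≡v w∈B)
... | yes v∈B = λ apart →
  nocutB v (v∈B , x , y , x≢v , y≢v , connB x y x∈B y∈B ,
            λ inB → apart (weaken G proj₂ inB))

lemma11 : ∀ {n} (k : ℕ) (G : Graph n) → IsCritical k G
          → (∃[ c ] IsCutVertex G c)
          → (D : Subset n) → IsGammaCSet G D
          → (B : Subset n) → IsBlock G B
          → (x y : Fin n) → x ∈ B → y ∈ B → (x≢y : x ≢ y) → ¬ E G x y
          → (Dxy : Subset n) → IsGammaCSet (addEdge G x y x≢y) Dxy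
          → (∀ v → IsCutVertex G v → (v ∈ D ⇔ v ∈ Dxy))
            × (∀ B' → IsBlock (addEdge G x y x≢y) B' →
                 ∀ v → IsCutVertex G v → v ∈ B' → (v ∈ D ⇔ v ∈ Dxy))
lemma11 k G _ _ D (cdsD , _) B (noCutB , _) x y x∈B y∈B x≢y _ Dxy (cdsDxy , _) =
  both , λ _ _ v cut _ → both v cut
  where
  both : ∀ v → IsCutVertex G v → (v ∈ D ⇔ v ∈ Dxy)
  both v cut = mk⇔ (λ _ → inDxy) (λ _ → inD)
    where
    pair = cut-vertex-separates G cut
    sep : Separates G v (proj₁ pair) (proj₁ (proj₂ pair))
    sep = proj₂ (proj₂ pair)
    inD : v ∈ D
    inD = cds-contains-separator G D cdsD sep
    inDxy : v ∈ Dxy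
    inDxy = cds-contains-separator (addEdge G x y x≢y) Dxy cdsDxy
              (separation-persists G x y x≢y v
                 (block-not-separated G B noCutB x∈B y∈B v) sep)
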